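{- Let $n\ge1$ and $0\le k\le n-1$ be integers and $M=2n-k$. For $T\in\mathrm{Inc}^k(2\times n)$ define $\mathcal{F}(T)$ as follows: let $A$ be the set of values appearing in both rows of $T$, and $B$ the set of values appearing in row 2 of $T$ immediately to the right of an element of $A$ (in row 2); let $T'$ be the filling of shape $(n-k,n-k)$ obtained by deleting the elements of $A$ from row 1 and the elements of $B$ from row 2 of $T$; and let $\mathcal{F}(T)$ be obtained from $T'$ by appending the elements of $B$, in increasing order from top to bottom, as $k$ additional boxes in the first column below the second row. Then $\mathcal{F}$ is a well-defined bijection from $\mathrm{Inc}^k(2\times n)$ onto $\mathrm{SYT}(n-k,n-k,1^k)$.
   Context: Partitions are identified with Young diagrams in English convention; $|\lambda|$ is the number of boxes; $2\times n$ is the partition $(n,n)$ and $(a,a,1^k)$ is the partition with two rows of length $a$ followed by $k$ rows of length 1. An increasing tableau of shape $\lambda$ is a filling of the boxes of $\lambda$ by positive integers, strictly increasing along rows and down columns, whose set of entries is $\{1,\dots,M\}$ for some $M$. $\mathrm{Inc}^k(\lambda)$ is the set of increasing tableaux of shape $\lambda$ with maximum entry $|\lambda|-k$; $\mathrm{SYT}(\lambda)=\mathrm{Inc}^0(\lambda)$ is the set of standard Young tableaux. Every value in $\{1,\dots,M\}$ appears in $T\in\mathrm{Inc}^k(2\times n)$ once or twice. -}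

module Defs where

open import Data.Nat using (ℕ; zero; suc; _<_; _≤_; _∸_; _≟_)
open import Data.Nat.Properties using (≤-decTotalOrder)
open import Data.List using (List; []; _∷_; map; length; concat; filter; replicate)
open import Data.Nat.ListAction using (sum)
open import Data.Bool using (if_then_else_)
open import Data.List.Relation.Unary.All using (All)
open import Data.List.Relation.Unary.Linked using (Linked)
open import Data.List.Membership.Propositional using (_∈_)
open import Data.List.Membership.DecPropositional _≟_ using (_∈?_; _∉?_)
open import Data.List.Sort ≤-decTotalOrder using (sort)
open import Data.Maybe using (Maybe; just; nothing)
open import Data.Product using (_×_)
open import Relation.Nullary using (does)
open import Relation.Binary.PropositionalEquality using (_≡_)

-- A filling of a Young diagram (English convention): the list of its rows,
-- each row listed from left to right, rows listed from top to bottom.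
Filling : Set
Filling = List (List ℕ)

Shape : Set
Shape = List ℕ

shape : Filling → Shape
shape = map length

size : Shape → ℕ
size = sum

twoBy : ℕ → Shape
twoBy n = n ∷ n ∷ []

twoRowsHook : ℕ → ℕ → Shape
twoRowsHook a k = a ∷ a ∷ replicate k 1

at : List ℕ → ℕ → Maybe ℕ
at []       _       = nothing
at (x ∷ xs) zero    = just x
at (x ∷ xs) (suc j) = at xs j

ColBelow : List ℕ → List ℕ → Set
ColBelow r r' = ∀ j x y → at r j ≡ just x → at r' j ≡ just y → x < y

IsInc : ℕ → Shape → Filling → Set
IsInc k sh T =
  shape T ≡ sh
  × All (Linked _<_) T
  × Linked ColBelow T
  × (∀ m → (m ∈ concat T → 1 ≤ m × m ≤ size sh ∸ k)
         × (1 ≤ m × m ≤ size sh ∸ k → m ∈ concat T))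

IsSYT : Shape → Filling → Set
IsSYT = IsInc 0

rightOfIn : List ℕ → List ℕ → List ℕ
rightOfIn A []           = []
rightOfIn A (x ∷ [])     = []
rightOfIn A (x ∷ y ∷ r) =
  if does (x ∈? A) then y ∷ rightOfIn A (y ∷ r) else rightOfIn A (y ∷ r)

-- The map 𝓕 (defined on two-row fillings; other inputs are irrelevant)
𝓕 : Filling → Filling
𝓕 (r1 ∷ r2 ∷ []) =
  let A  = filter (λ x → x ∈? r2) r1
      B  = rightOfIn A r2
      r1' = filter (λ x → x ∉? A) r1
      r2' = filter (λ x → x ∉? B) r2
  in r1' ∷ r2' ∷ map (λ b → b ∷ []) (sort B)
𝓕 T = T

module Submission where

-- A filling with values 1, …, M is recorded by its word, the list of labels of
-- 1, …, M, each label saying whether the value lies in row 1, in row 2, or in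
-- the column below row 2; the rows of the filling are the position lists of
-- the word.  The proof moves everything to words:
--   * increasing rows that together cover {1, …, M} are exactly the position
--     lists of a word, and they determine the word (decode, positions-injective);
--   * column strictness between rows 1 and 2 is a ballot condition on the word
--     (ballot⇒stacked, stacked⇒ballot), so Inc^k(2 × n) corresponds to ballot
--     words in the labels top/bottom/both (IncWord) and SYT(a, a, 1^k) to ballot
--     words in top/bottom/col where no column entry precedes row 2 (SytWord);
--   * on encoded fillings 𝓕 is a left-to-right transducer on words (𝓕-word,
--     toSytWord), with an inverse toIncWord that looks one entry ahead.

open import Data.Bool using (Bool; true; false; not; _∨_)
open import Data.Empty using (⊥-elim)
open import Data.List using (List; []; _∷_; [_]; _++_; map; length; concat; filter; replicate; take)
open import Data.List.Membership.Propositional using (_∈_; _∉_)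
open import Data.List.Membership.Propositional.Properties using (∈-++⁺ˡ; ∈-++⁺ʳ; ∈-++⁻; ∈-filter⁺; ∈-filter⁻)
open import Data.List.Properties using (∷-injectiveˡ; ∷-injectiveʳ; map-injective; ++-assoc; length-++; filter-accept; filter-reject; concat-map-[_])
open import Data.List.Relation.Binary.Permutation.Propositional using (↭⇒↭ₛ)
open import Data.List.Relation.Binary.Pointwise using (Pointwise-≡⇒≡)
open import Data.List.Relation.Unary.All as All using (All; []; _∷_)
open import Data.List.Relation.Unary.All.Properties as Allₚ using (++⁺)
open import Data.List.Relation.Unary.AllPairs using (_∷_)
open import Data.List.Relation.Unary.Any using (here; there)
open import Data.List.Relation.Unary.Linked as Linked using (Linked; []; [-]; _∷_)
open import Data.List.Relation.Unary.Linked.Properties as Linkedₚ using (Linked⇒AllPairs)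
open import Data.List.Relation.Unary.Sorted.TotalOrder.Properties using (↗↭↗⇒≋)
open import Data.Nat using (ℕ; zero; suc; _+_; _<_; _≤_; _∸_; _≟_; z≤n; s≤s; z<s)
open import Data.List.Membership.DecPropositional _≟_ using (_∈?_; _∉?_)
open import Data.Nat.ListAction using (sum)
open import Data.Nat.Properties
open import Data.List.Sort ≤-decTotalOrder using (sort; sort-↭; sort-↗)
open import Data.Nat.Solver using (module +-*-Solver)
open import Data.Product using (_×_; _,_; proj₁; proj₂; ∃; ∃₂)
open import Data.Sum as Sum using (_⊎_; inj₁; inj₂)
open import Function using (_∘′_)
open import Relation.Binary.Bundles using (DecTotalOrder)
open import Relation.Binary.PropositionalEquality using (_≡_; _≢_; refl; sym; trans; cong; cong₂; subst; subst₂; ≢-sym; module ≡-Reasoning)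
open import Relation.Nullary using (¬_; yes; no; does)
open import Relation.Nullary.Decidable using (dec-true; dec-false)
open import Relation.Unary using (Decidable)

open import Defs

data Label : Set where
  lab : (row₁ row₂ column : Bool) → Label

inRow₁ inRow₂ inColumn : Label → Bool
inRow₁   (lab a _ _) = a
inRow₂   (lab _ b _) = b
inColumn (lab _ _ c) = c

pattern top    = lab true  false false
pattern bottom = lab false true  false
pattern both   = lab true  true  false
pattern col    = lab false false true

-- The word of a filling with entries in {m, m+1, …} lists the labels of m, m+1, ….
Word : Set
Word = List Label

Increasing : List ℕ → Set
Increasing = Linked _<_

consIf : Bool → ℕ → List ℕ → List ℕ
consIf true  m xs = m ∷ xs
consIf false m xs = xs

positions : (Label → Bool) → ℕ → Word → List ℕ
positions f m []      = []
positions f m (l ∷ w) = consIf (f l) m (positions f (suc m) w)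

bit : Bool → ℕ
bit true  = 1
bit false = 0

count : (Label → Bool) → Word → ℕ
count f []      = 0
count f (l ∷ w) = bit (f l) + count f w

All-consIf : ∀ {P : ℕ → Set} b {m xs} → P m → All P xs → All P (consIf b m xs)
All-consIf true  pm pxs = pm ∷ pxs
All-consIf false pm pxs = pxs

All-consIf⁻ : ∀ {P : ℕ → Set} b {m xs} → All P (consIf b m xs) → All P xs
All-consIf⁻ true  (_ ∷ pxs) = pxs
All-consIf⁻ false pxs       = pxs

∈-consIf⁺ : ∀ b {v m xs} → v ∈ xs → v ∈ consIf b m xs
∈-consIf⁺ true  v∈xs = there v∈xs
∈-consIf⁺ false v∈xs = v∈xs

∈-consIf⁻ : ∀ b {v m xs} → v ∈ consIf b m xs → v ≢ m → v ∈ xs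
∈-consIf⁻ true  (here refl) v≢m = ⊥-elim (v≢m refl)
∈-consIf⁻ true  (there v∈xs) _  = v∈xs
∈-consIf⁻ false v∈xs         _  = v∈xs

<-∉ : ∀ {m xs} → All (m <_) xs → m ∉ xs
<-∉ m<xs m∈xs = <-irrefl refl (All.lookup m<xs m∈xs)

<-≢ : ∀ {m v xs} → All (m <_) xs → v ∈ xs → v ≢ m
<-≢ m<xs v∈xs refl = <-∉ m<xs v∈xs

∉-∷ : ∀ {m v xs ys} → All (m <_) xs → v ∈ xs → v ∉ ys → v ∉ m ∷ ys
∉-∷ m<xs v∈xs _    (here refl)  = <-∉ m<xs v∈xs
∉-∷ _    _    v∉ys (there v∈ys) = v∉ys v∈ys

consIf-injective : ∀ b b′ {m xs ys} → All (m <_) xs → All (m <_) ys →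
                   consIf b m xs ≡ consIf b′ m ys → b ≡ b′ × xs ≡ ys
consIf-injective true  true  _    _    eq = refl , ∷-injectiveʳ eq
consIf-injective true  false _    m<ys eq = ⊥-elim (<-∉ m<ys (subst (_ ∈_) eq (here refl)))
consIf-injective false true  m<xs _    eq = ⊥-elim (<-∉ m<xs (subst (_ ∈_) (sym eq) (here refl)))
consIf-injective false false _    _    eq = refl , eq

length-consIf : ∀ b m xs → length (consIf b m xs) ≡ bit b + length xs
length-consIf true  m xs = refl
length-consIf false m xs = refl

∷-increasing : ∀ {m xs} → All (m <_) xs → Increasing xs → Increasing (m ∷ xs)
∷-increasing {xs = []}    _          _   = [-]
∷-increasing {xs = _ ∷ _} (m<x ∷ _) inc = m<x ∷ inc

consIf-increasing : ∀ b {m xs} → All (m <_) xs → Increasing xs → Increasing (consIf b m xs)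
consIf-increasing true  m<xs inc = ∷-increasing m<xs inc
consIf-increasing false _    inc = inc

head-below : ∀ {y ys} → Increasing (y ∷ ys) → All (y <_) ys
head-below inc with Linked⇒AllPairs <-trans inc
... | y<ys ∷ _ = y<ys

positions-≥ : ∀ f m w → All (m ≤_) (positions f m w)
positions-≥ f m []      = []
positions-≥ f m (l ∷ w) =
  All-consIf (f l) ≤-refl (All.map <⇒≤ (positions-≥ f (suc m) w))

positions-> : ∀ f m w → All (m <_) (positions f (suc m) w)
positions-> f m w = positions-≥ f (suc m) w

positions-< : ∀ f m w → All (_< m + length w) (positions f m w)
positions-< f m []      = []
positions-< f m (l ∷ w) = All-consIf (f l) (m<m+n m z<s)
  (All.map (λ {v} v< → subst (v <_) (sym (+-suc m (length w))) v<) (positions-< f (suc m) w))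

positions-increasing : ∀ f m w → Increasing (positions f m w)
positions-increasing f m []      = []
positions-increasing f m (l ∷ w) =
  consIf-increasing (f l) (positions-> f m w) (positions-increasing f (suc m) w)

length-positions : ∀ f m w → length (positions f m w) ≡ count f w
length-positions f m []      = refl
length-positions f m (l ∷ w) =
  trans (length-consIf (f l) m _) (cong (bit (f l) +_) (length-positions f (suc m) w))

Occupied : Label → Set
Occupied l = inRow₁ l ∨ inRow₂ l ∨ inColumn l ≡ true

Covers : ℕ → ℕ → List ℕ → List ℕ → List ℕ → Set
Covers m K r₁ r₂ c = ∀ v → m ≤ v → v < m + K → v ∈ r₁ ⊎ v ∈ r₂ ⊎ v ∈ c

positions-cover : ∀ m w → All Occupied w →
  Covers m (length w) (positions inRow₁ m w) (positions inRow₂ m w) (positions inColumn m w)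
positions-cover m []      _ v m≤v v< = ⊥-elim (<-irrefl refl (≤-<-trans m≤v (subst (v <_) (+-identityʳ m) v<)))
positions-cover m (lab a b c ∷ w) (occ ∷ occs) v m≤v v< with v ≟ m
positions-cover m (lab true  _    _    ∷ w) (_  ∷ _) v _ _ | yes refl = inj₁ (here refl)
positions-cover m (lab false true _    ∷ w) (_  ∷ _) v _ _ | yes refl = inj₂ (inj₁ (here refl))
positions-cover m (lab false false true ∷ w) (_ ∷ _) v _ _ | yes refl = inj₂ (inj₂ (here refl))
positions-cover m (lab false false false ∷ w) (() ∷ _) v _ _ | yes refl
... | no v≢m with positions-cover (suc m) w occs v (≤∧≢⇒< m≤v (≢-sym v≢m)) (subst (v <_) (+-suc m (length w)) v<)
... | inj₁ v∈        = inj₁ (∈-consIf⁺ a v∈)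
... | inj₂ (inj₁ v∈) = inj₂ (inj₁ (∈-consIf⁺ b v∈))
... | inj₂ (inj₂ v∈) = inj₂ (inj₂ (∈-consIf⁺ c v∈))

∈-++³⁺ : ∀ {v : ℕ} {xs ys zs} → v ∈ xs ⊎ v ∈ ys ⊎ v ∈ zs → v ∈ xs ++ (ys ++ zs)
∈-++³⁺           (inj₁ v∈)        = ∈-++⁺ˡ v∈
∈-++³⁺ {xs = xs} (inj₂ (inj₁ v∈)) = ∈-++⁺ʳ xs (∈-++⁺ˡ v∈)
∈-++³⁺ {xs = xs} {ys} (inj₂ (inj₂ v∈)) = ∈-++⁺ʳ xs (∈-++⁺ʳ ys v∈)

∈-++³⁻ : ∀ {v : ℕ} xs ys {zs} → v ∈ xs ++ (ys ++ zs) → v ∈ xs ⊎ v ∈ ys ⊎ v ∈ zs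
∈-++³⁻ xs ys v∈ with ∈-++⁻ xs v∈
... | inj₁ v∈xs = inj₁ v∈xs
... | inj₂ v∈′ with ∈-++⁻ ys v∈′
...   | inj₁ v∈ys = inj₂ (inj₁ v∈ys)
...   | inj₂ v∈zs = inj₂ (inj₂ v∈zs)

entries : Word → List ℕ
entries w = positions inRow₁ 1 w ++ (positions inRow₂ 1 w ++ positions inColumn 1 w)

ValuesUpTo : ℕ → List ℕ → Set
ValuesUpTo N xs = ∀ v → (v ∈ xs → 1 ≤ v × v ≤ N) × (1 ≤ v × v ≤ N → v ∈ xs)

entries-values : ∀ w → All Occupied w → ValuesUpTo (length w) (entries w)
entries-values w occs v = bounded ∘′ ∈-++³⁻ (positions inRow₁ 1 w) (positions inRow₂ 1 w) , covered
  where
  inRange : ∀ f → v ∈ positions f 1 w → 1 ≤ v × v ≤ length w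
  inRange f v∈ = All.lookup (positions-≥ f 1 w) v∈ , ≤-pred (All.lookup (positions-< f 1 w) v∈)
  bounded : v ∈ positions inRow₁ 1 w ⊎ v ∈ positions inRow₂ 1 w ⊎ v ∈ positions inColumn 1 w → 1 ≤ v × v ≤ length w
  bounded (inj₁ v∈)        = inRange inRow₁ v∈
  bounded (inj₂ (inj₁ v∈)) = inRange inRow₂ v∈
  bounded (inj₂ (inj₂ v∈)) = inRange inColumn v∈
  covered : 1 ≤ v × v ≤ length w → v ∈ entries w
  covered (1≤v , v≤M) = ∈-++³⁺ (positions-cover 1 w occs v 1≤v (s≤s v≤M))

InRange : ℕ → ℕ → List ℕ → Set
InRange m K xs = Increasing xs × All (m ≤_) xs × All (_< m + K) xs

empty-range : ∀ {m xs} → InRange m 0 xs → xs ≡ []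
empty-range {m} {[]}    _                    = refl
empty-range {m} {x ∷ _} (_ , m≤x ∷ _ , x< ∷ _) =
  ⊥-elim (<-irrefl refl (≤-<-trans m≤x (subst (x <_) (+-identityʳ m) x<)))

peel : ∀ {m K} xs → InRange m (suc K) xs →
       ∃₂ λ b ys → xs ≡ consIf b m ys × InRange (suc m) K ys
peel []                    _ = false , [] , refl , [] , [] , []
peel {m} {K} (y ∷ ys) (inc , m≤y ∷ _ , y<ys) with y ≟ m
... | yes refl = true , ys , refl , Linked.tail inc , head-below inc ,
                 All.map (λ {v} → subst (v <_) (+-suc m K)) (All-consIf⁻ true y<ys)
... | no y≢m   = false , y ∷ ys , refl , inc , m<y ∷ All.map (<-trans m<y) (head-below inc) ,
                 All.map (λ {v} → subst (v <_) (+-suc m K)) y<ys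
  where
  m<y : m < y
  m<y = ≤∧≢⇒< m≤y (≢-sym y≢m)

covers-tail : ∀ {m K} b₁ b₂ b₃ {r₁ r₂ c} →
  Covers m (suc K) (consIf b₁ m r₁) (consIf b₂ m r₂) (consIf b₃ m c) → Covers (suc m) K r₁ r₂ c
covers-tail {m} {K} b₁ b₂ b₃ cov v m<v v< =
  Sum.map (drop b₁) (Sum.map (drop b₂) (drop b₃)) (cov v (<⇒≤ m<v) (subst (v <_) (sym (+-suc m K)) v<))
  where
  drop : ∀ b {xs} → v ∈ consIf b m xs → v ∈ xs
  drop b v∈ = ∈-consIf⁻ b v∈ (λ v≡m → <-irrefl (sym v≡m) m<v)

covers-head : ∀ {m K} b₁ b₂ b₃ {r₁ r₂ c} → All (m <_) r₁ → All (m <_) r₂ → All (m <_) c →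
  Covers m (suc K) (consIf b₁ m r₁) (consIf b₂ m r₂) (consIf b₃ m c) → Occupied (lab b₁ b₂ b₃)
covers-head true  _     _     _ _ _ _ = refl
covers-head false true  _     _ _ _ _ = refl
covers-head false false true  _ _ _ _ = refl
covers-head {m} false false false m<r₁ m<r₂ m<c cov with cov m ≤-refl (m<m+n m z<s)
... | inj₁ m∈        = ⊥-elim (<-∉ m<r₁ m∈)
... | inj₂ (inj₁ m∈) = ⊥-elim (<-∉ m<r₂ m∈)
... | inj₂ (inj₂ m∈) = ⊥-elim (<-∉ m<c m∈)

decode : ∀ K m r₁ r₂ c → InRange m K r₁ → InRange m K r₂ → InRange m K c → Covers m K r₁ r₂ c →
  ∃ λ w → length w ≡ K × All Occupied w ×
          positions inRow₁ m w ≡ r₁ × positions inRow₂ m w ≡ r₂ × positions inColumn m w ≡ c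
decode zero m r₁ r₂ c in₁ in₂ in₃ _
  rewrite empty-range in₁ | empty-range in₂ | empty-range in₃ = [] , refl , [] , refl , refl , refl
decode (suc K) m r₁ r₂ c in₁ in₂ in₃ cov with peel r₁ in₁ | peel r₂ in₂ | peel c in₃
... | b₁ , r₁′ , refl , in₁′ | b₂ , r₂′ , refl , in₂′ | b₃ , c′ , refl , in₃′
  with decode K (suc m) r₁′ r₂′ c′ in₁′ in₂′ in₃′ (covers-tail b₁ b₂ b₃ cov)
... | w , refl , occs , refl , refl , refl =
  lab b₁ b₂ b₃ ∷ w , refl ,
  covers-head b₁ b₂ b₃ (proj₁ (proj₂ in₁′)) (proj₁ (proj₂ in₂′)) (proj₁ (proj₂ in₃′)) cov ∷ occs ,
  refl , refl , refl

positions-injective : ∀ m u u′ → All Occupied u → All Occupied u′ →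
  positions inRow₁ m u ≡ positions inRow₁ m u′ → positions inRow₂ m u ≡ positions inRow₂ m u′ →
  positions inColumn m u ≡ positions inColumn m u′ → u ≡ u′
positions-injective m [] [] _ _ _ _ _ = refl
positions-injective m [] (lab true  _     _    ∷ _) _ _ () _ _
positions-injective m [] (lab false true  _    ∷ _) _ _ _ () _
positions-injective m [] (lab false false true ∷ _) _ _ _ _ ()
positions-injective m [] (lab false false false ∷ _) _ (() ∷ _) _ _ _
positions-injective m (lab true  _     _    ∷ _) [] _ _ () _ _
positions-injective m (lab false true  _    ∷ _) [] _ _ _ () _
positions-injective m (lab false false true ∷ _) [] _ _ _ _ ()
positions-injective m (lab false false false ∷ _) [] (() ∷ _) _ _ _ _
positions-injective m (lab a b c ∷ u) (lab a′ b′ c′ ∷ u′) (_ ∷ occs) (_ ∷ occs′) eq₁ eq₂ eq₃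
  with consIf-injective a a′ (positions-> inRow₁ m u) (positions-> inRow₁ m u′) eq₁
     | consIf-injective b b′ (positions-> inRow₂ m u) (positions-> inRow₂ m u′) eq₂
     | consIf-injective c c′ (positions-> inColumn m u) (positions-> inColumn m u′) eq₃
... | refl , eq₁′ | refl , eq₂′ | refl , eq₃′ = cong (lab a b c ∷_) (positions-injective (suc m) u u′ occs occs′ eq₁′ eq₂′ eq₃′)

data Stacked : List ℕ → List ℕ → Set where
  nil₁ : ∀ {r′} → Stacked [] r′
  nil₂ : ∀ {x r} → Stacked (x ∷ r) []
  cell : ∀ {x y r r′} → x < y → Stacked r r′ → Stacked (x ∷ r) (y ∷ r′)

Stacked⇒ColBelow : ∀ {r r′} → Stacked r r′ → ColBelow r r′
Stacked⇒ColBelow nil₁           j       x y ()   _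
Stacked⇒ColBelow nil₂           j       x y _    ()
Stacked⇒ColBelow (cell x<y _)   zero    x y refl refl = x<y
Stacked⇒ColBelow (cell _ below) (suc j) x y eq   eq′  = Stacked⇒ColBelow below j x y eq eq′

ColBelow⇒Stacked : ∀ r r′ → ColBelow r r′ → Stacked r r′
ColBelow⇒Stacked []      r′       _     = nil₁
ColBelow⇒Stacked (x ∷ r) []       _     = nil₂
ColBelow⇒Stacked (x ∷ r) (y ∷ r′) below =
  cell (below zero x y refl refl) (ColBelow⇒Stacked r r′ (λ j → below (suc j)))

stacked-[] : ∀ r → Stacked r []
stacked-[] []      = nil₁
stacked-[] (_ ∷ _) = nil₂

data Simple : Label → Set where
  isTop    : Simple top
  isBottom : Simple bottom
  isBoth   : Simple both
  isCol    : Simple col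

-- Ballot d w: reading w from the left with d row-1 entries waiting for a
-- row-2 entry below them, every row-2 entry takes a waiting row-1 entry,
-- and at the end no row-1 entry is left waiting.
data Ballot : ℕ → Word → Set where
  []      : Ballot 0 []
  top∷_    : ∀ {d w} → Ballot (suc d) w → Ballot d (top ∷ w)
  bottom∷_ : ∀ {d w} → Ballot d w → Ballot (suc d) (bottom ∷ w)
  both∷_   : ∀ {d w} → Ballot (suc d) w → Ballot (suc d) (both ∷ w)
  col∷_    : ∀ {d w} → Ballot d w → Ballot d (col ∷ w)

ballot-count : ∀ {d w} → Ballot d w → d + count inRow₁ w ≡ count inRow₂ w
ballot-count []                   = refl
ballot-count (top∷_ {d} {w} b)    = trans (+-suc d (count inRow₁ w)) (ballot-count b)
ballot-count (bottom∷ b)          = cong suc (ballot-count b)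
ballot-count (both∷_ {d} {w} b)   = cong suc (trans (+-suc d (count inRow₁ w)) (ballot-count b))
ballot-count (col∷ b)             = ballot-count b

length-∷ʳ : ∀ (q : List ℕ) m → length (q ++ m ∷ []) ≡ suc (length q)
length-∷ʳ q m = trans (length-++ q) (+-comm (length q) 1)

below-∷ʳ : ∀ {m} q → All (_< m) q → All (_< suc m) (q ++ m ∷ [])
below-∷ʳ q q<m = ++⁺ (All.map m<n⇒m<1+n q<m) (≤-refl ∷ [])

below-suc : ∀ {m} {q : List ℕ} → All (_< m) q → All (_< suc m) q
below-suc = All.map m<n⇒m<1+n

enqueue : ∀ (q : List ℕ) m rest → (q ++ m ∷ []) ++ rest ≡ q ++ m ∷ rest
enqueue q m rest = ++-assoc q (m ∷ []) rest

-- The waiting queue q holds the row-1 entries (all below m) not yet matched;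
-- a ballot word then stacks row 2 under row 1.
ballot⇒stacked : ∀ {d w} → Ballot d w → ∀ m q → length q ≡ d → All (_< m) q →
                 Stacked (q ++ positions inRow₁ m w) (positions inRow₂ m w)
ballot⇒stacked []                    m q       _   _          = stacked-[] _
ballot⇒stacked (top∷_ {w = w} b)      m q       len q<m        =
  subst (λ r → Stacked r (positions inRow₂ (suc m) w)) (enqueue q m _)
    (ballot⇒stacked b (suc m) (q ++ m ∷ []) (trans (length-∷ʳ q m) (cong suc len)) (below-∷ʳ q q<m))
ballot⇒stacked (bottom∷ b)            m (x ∷ q) len (x<m ∷ q<m) =
  cell x<m (ballot⇒stacked b (suc m) q (suc-injective len) (below-suc q<m))
ballot⇒stacked (both∷_ {w = w} b)     m (x ∷ q) len (x<m ∷ q<m) =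
  cell x<m (subst (λ r → Stacked r (positions inRow₂ (suc m) w)) (enqueue q m _)
    (ballot⇒stacked b (suc m) (q ++ m ∷ []) (trans (length-∷ʳ q m) len) (below-∷ʳ q q<m)))
ballot⇒stacked (col∷ b)               m q       len q<m        =
  ballot⇒stacked b (suc m) q len (below-suc q<m)

-- A row-2 entry m with no waiting row-1 entry would have to sit below a larger value.
unmatched-bottom : ∀ {m} xs ys → All (m <_) xs → 1 ≤ length xs → ¬ Stacked xs (m ∷ ys)
unmatched-bottom (x ∷ _) _ (m<x ∷ _) _ (cell x<m _) = <-asym m<x x<m

mutual
  stacked⇒ballot : ∀ w m q → All Simple w → All (_< m) q →
    Stacked (q ++ positions inRow₁ m w) (positions inRow₂ m w) →
    length q + count inRow₁ w ≡ count inRow₂ w → Ballot (length q) w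
  stacked⇒ballot [] m []      _ _ _ _  = []
  stacked⇒ballot [] m (_ ∷ _) _ _ _ ()
  stacked⇒ballot (top ∷ w) m q (isTop ∷ simple) q<m below counts =
    top∷ enqueued w m q simple q<m below (trans (sym (+-suc (length q) _)) counts)
  stacked⇒ballot (bottom ∷ w) m (x ∷ q) (isBottom ∷ simple) (_ ∷ q<m) (cell _ below) counts =
    bottom∷ stacked⇒ballot w (suc m) q simple (below-suc q<m) below (suc-injective counts)
  stacked⇒ballot (bottom ∷ w) m [] (isBottom ∷ _) _ below counts =
    ⊥-elim (unmatched-bottom (positions inRow₁ (suc m) w) _ (positions-> inRow₁ m w)
      (subst (1 ≤_) (sym (trans (length-positions inRow₁ (suc m) w) counts)) (s≤s z≤n)) below)
  stacked⇒ballot (both ∷ w) m (x ∷ q) (isBoth ∷ simple) (_ ∷ q<m) (cell _ below) counts =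
    both∷ enqueued w m q simple q<m below (trans (sym (+-suc (length q) _)) (suc-injective counts))
  stacked⇒ballot (both ∷ w) m [] (isBoth ∷ _) _ (cell m<m _) _ = ⊥-elim (<-irrefl refl m<m)
  stacked⇒ballot (col ∷ w) m q (isCol ∷ simple) q<m below counts =
    col∷ stacked⇒ballot w (suc m) q simple (below-suc q<m) below counts

  enqueued : ∀ w m q → All Simple w → All (_< m) q →
    Stacked (q ++ m ∷ positions inRow₁ (suc m) w) (positions inRow₂ (suc m) w) →
    suc (length q) + count inRow₁ w ≡ count inRow₂ w → Ballot (suc (length q)) w
  enqueued w m q simple q<m below counts =
    subst (λ d → Ballot d w) (length-∷ʳ q m)
      (stacked⇒ballot w (suc m) (q ++ m ∷ []) simple (below-∷ʳ q q<m)
        (subst (λ r → Stacked r (positions inRow₂ (suc m) w)) (sym (enqueue q m _)) below)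
        (trans (cong (_+ count inRow₁ w) (length-∷ʳ q m)) counts))

data IncBallot : ℕ → Word → Set where
  []      : IncBallot 0 []
  top∷_    : ∀ {d w} → IncBallot (suc d) w → IncBallot d (top ∷ w)
  bottom∷_ : ∀ {d w} → IncBallot d w → IncBallot (suc d) (bottom ∷ w)
  both∷_   : ∀ {d w} → IncBallot (suc d) w → IncBallot (suc d) (both ∷ w)

-- Words of standard tableaux of shape (a, a, 1^k): every value is in exactly one
-- of row 1, row 2, the column; the ballot condition holds; and, as recorded by
-- the flag, a column entry is only read after some row-2 entry (the first
-- column entry lies below the first entry of row 2).
data SytBallot : Bool → ℕ → Word → Set where
  []      : ∀ {s} → SytBallot s 0 []
  top∷_    : ∀ {s d w} → SytBallot s (suc d) w → SytBallot s d (top ∷ w)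
  bottom∷_ : ∀ {s d w} → SytBallot true d w → SytBallot s (suc d) (bottom ∷ w)
  col∷_    : ∀ {d w} → SytBallot true d w → SytBallot true d (col ∷ w)

-- 𝓕 on words. The flag says that the previous row-2 entry lies in both rows,
-- so the current row-2 entry is in B and moves to the column; a value in
-- both rows is deleted from row 1.
toSytWord : Bool → Word → Word
toSytWord carry []                  = []
toSytWord carry (lab a true c ∷ w)  = lab false (not carry) carry ∷ toSytWord a w
toSytWord carry (lab a false c ∷ w) = lab a false c ∷ toSytWord carry w

nextInColumn : Word → Bool
nextInColumn []                     = false
nextInColumn (lab _ true c ∷ _)     = c
nextInColumn (lab _ false true ∷ _) = true
nextInColumn (lab _ false false ∷ u) = nextInColumn u

-- The inverse of 𝓕 on words: a row-2 or column entry returns to row 2, and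
-- is also put back into row 1 when the next such entry comes from the column.
toIncWord : Word → Word
toIncWord []                       = []
toIncWord (lab _ true _ ∷ u)       = lab (nextInColumn u) true false ∷ toIncWord u
toIncWord (lab _ false true ∷ u)   = lab (nextInColumn u) true false ∷ toIncWord u
toIncWord (lab a false false ∷ u)  = lab a false false ∷ toIncWord u

mutual
  toSyt-ballot : ∀ {s d w} → IncBallot d w → SytBallot s d (toSytWord false w)
  toSyt-ballot []         = []
  toSyt-ballot (top∷ b)    = top∷ toSyt-ballot b
  toSyt-ballot (bottom∷ b) = bottom∷ toSyt-ballot b
  toSyt-ballot (both∷ b)   = bottom∷ toSyt-ballot-carry b

  toSyt-ballot-carry : ∀ {d w} → IncBallot (suc d) w → SytBallot true d (toSytWord true w)
  toSyt-ballot-carry (top∷ b)    = top∷ toSyt-ballot-carry b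
  toSyt-ballot-carry (bottom∷ b) = col∷ toSyt-ballot b
  toSyt-ballot-carry (both∷ b)   = col∷ toSyt-ballot-carry b

mutual
  toInc-ballot : ∀ {s d u} → SytBallot s d u → nextInColumn u ≡ false → IncBallot d (toIncWord u)
  toInc-ballot []         _ = []
  toInc-ballot (top∷ b)    next = top∷ toInc-ballot b next
  toInc-ballot (bottom∷_ {w = u} b) _ with nextInColumn u in next
  ... | false = bottom∷ toInc-ballot b next
  ... | true  = both∷ toInc-ballot-carry b next

  toInc-ballot-carry : ∀ {d u} → SytBallot true d u → nextInColumn u ≡ true → IncBallot (suc d) (toIncWord u)
  toInc-ballot-carry (top∷ b)  next = top∷ toInc-ballot-carry b next
  toInc-ballot-carry (col∷_ {w = u} b) _ with nextInColumn u in next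
  ... | false = bottom∷ toInc-ballot b next
  ... | true  = both∷ toInc-ballot-carry b next

nextInColumn-start : ∀ {d u} → SytBallot false d u → nextInColumn u ≡ false
nextInColumn-start []          = refl
nextInColumn-start (top∷ b)    = nextInColumn-start b
nextInColumn-start (bottom∷ b) = refl

mutual
  nextInColumn-toSyt : ∀ {d w} → IncBallot d w → nextInColumn (toSytWord false w) ≡ false
  nextInColumn-toSyt []          = refl
  nextInColumn-toSyt (top∷ b)    = nextInColumn-toSyt b
  nextInColumn-toSyt (bottom∷ b) = refl
  nextInColumn-toSyt (both∷ b)   = refl

  nextInColumn-toSyt-carry : ∀ {d w} → IncBallot (suc d) w → nextInColumn (toSytWord true w) ≡ true
  nextInColumn-toSyt-carry (top∷ b)    = nextInColumn-toSyt-carry b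
  nextInColumn-toSyt-carry (bottom∷ b) = refl
  nextInColumn-toSyt-carry (both∷ b)   = refl

toSyt-toInc : ∀ {s d u} → SytBallot s d u → toSytWord (nextInColumn u) (toIncWord u) ≡ u
toSyt-toInc []          = refl
toSyt-toInc (top∷ b)    = cong (top ∷_) (toSyt-toInc b)
toSyt-toInc (bottom∷ b) = cong (bottom ∷_) (toSyt-toInc b)
toSyt-toInc (col∷ b)    = cong (col ∷_) (toSyt-toInc b)

mutual
  toInc-toSyt : ∀ {d w} → IncBallot d w → toIncWord (toSytWord false w) ≡ w
  toInc-toSyt []          = refl
  toInc-toSyt (top∷ b)    = cong (top ∷_) (toInc-toSyt b)
  toInc-toSyt (bottom∷ b) = cong₂ (λ a w → lab a true false ∷ w) (nextInColumn-toSyt b) (toInc-toSyt b)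
  toInc-toSyt (both∷ b)   = cong₂ (λ a w → lab a true false ∷ w) (nextInColumn-toSyt-carry b) (toInc-toSyt-carry b)

  toInc-toSyt-carry : ∀ {d w} → IncBallot (suc d) w → toIncWord (toSytWord true w) ≡ w
  toInc-toSyt-carry (top∷ b)    = cong (top ∷_) (toInc-toSyt-carry b)
  toInc-toSyt-carry (bottom∷ b) = cong₂ (λ a w → lab a true false ∷ w) (nextInColumn-toSyt b) (toInc-toSyt b)
  toInc-toSyt-carry (both∷ b)   = cong₂ (λ a w → lab a true false ∷ w) (nextInColumn-toSyt-carry b) (toInc-toSyt-carry b)

-- Row 1 of T is split by 𝓕 between row 1 (values not in A) and the column (B, one per value of A).
mutual
  count-toSyt : ∀ {d w} → IncBallot d w →
    count inRow₁ w ≡ count inRow₁ (toSytWord false w) + count inColumn (toSytWord false w)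
  count-toSyt []          = refl
  count-toSyt (top∷ b)    = cong suc (count-toSyt b)
  count-toSyt (bottom∷ b) = count-toSyt b
  count-toSyt (both∷ b)   = count-toSyt-carry b

  count-toSyt-carry : ∀ {d w} → IncBallot (suc d) w →
    suc (count inRow₁ w) ≡ count inRow₁ (toSytWord true w) + count inColumn (toSytWord true w)
  count-toSyt-carry (top∷ b) = cong suc (count-toSyt-carry b)
  count-toSyt-carry {w = bottom ∷ w} (bottom∷ b) =
    trans (cong suc (count-toSyt b)) (sym (+-suc (count inRow₁ (toSytWord false w)) _))
  count-toSyt-carry {w = both ∷ w} (both∷ b) =
    trans (cong suc (count-toSyt-carry b)) (sym (+-suc (count inRow₁ (toSytWord true w)) _))

length-toSyt : ∀ carry w → length (toSytWord carry w) ≡ length w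
length-toSyt carry []                  = refl
length-toSyt carry (lab a true c ∷ w)  = cong suc (length-toSyt a w)
length-toSyt carry (lab a false c ∷ w) = cong suc (length-toSyt carry w)

data IncLabel : Label → Set where
  isTop    : IncLabel top
  isBottom : IncLabel bottom
  isBoth   : IncLabel both

data SytLabel : Label → Set where
  isTop    : SytLabel top
  isBottom : SytLabel bottom
  isCol    : SytLabel col

IncLabel⇒Simple : ∀ {l} → IncLabel l → Simple l
IncLabel⇒Simple isTop    = isTop
IncLabel⇒Simple isBottom = isBottom
IncLabel⇒Simple isBoth   = isBoth

SytLabel⇒Simple : ∀ {l} → SytLabel l → Simple l
SytLabel⇒Simple isTop    = isTop
SytLabel⇒Simple isBottom = isBottom
SytLabel⇒Simple isCol    = isCol

Simple⇒Occupied : ∀ {l} → Simple l → Occupied l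
Simple⇒Occupied isTop    = refl
Simple⇒Occupied isBottom = refl
Simple⇒Occupied isBoth   = refl
Simple⇒Occupied isCol    = refl

IncBallot⇒Ballot : ∀ {d w} → IncBallot d w → Ballot d w
IncBallot⇒Ballot []          = []
IncBallot⇒Ballot (top∷ b)    = top∷ IncBallot⇒Ballot b
IncBallot⇒Ballot (bottom∷ b) = bottom∷ IncBallot⇒Ballot b
IncBallot⇒Ballot (both∷ b)   = both∷ IncBallot⇒Ballot b

IncBallot⇒labels : ∀ {d w} → IncBallot d w → All IncLabel w
IncBallot⇒labels []          = []
IncBallot⇒labels (top∷ b)    = isTop ∷ IncBallot⇒labels b
IncBallot⇒labels (bottom∷ b) = isBottom ∷ IncBallot⇒labels b
IncBallot⇒labels (both∷ b)   = isBoth ∷ IncBallot⇒labels b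

Ballot⇒IncBallot : ∀ {d w} → Ballot d w → All IncLabel w → IncBallot d w
Ballot⇒IncBallot []          _         = []
Ballot⇒IncBallot (top∷ b)    (_ ∷ ls)  = top∷ Ballot⇒IncBallot b ls
Ballot⇒IncBallot (bottom∷ b) (_ ∷ ls)  = bottom∷ Ballot⇒IncBallot b ls
Ballot⇒IncBallot (both∷ b)   (_ ∷ ls)  = both∷ Ballot⇒IncBallot b ls
Ballot⇒IncBallot (col∷ b)    (() ∷ _)

SytBallot⇒Ballot : ∀ {s d w} → SytBallot s d w → Ballot d w
SytBallot⇒Ballot []          = []
SytBallot⇒Ballot (top∷ b)    = top∷ SytBallot⇒Ballot b
SytBallot⇒Ballot (bottom∷ b) = bottom∷ SytBallot⇒Ballot b
SytBallot⇒Ballot (col∷ b)    = col∷ SytBallot⇒Ballot b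

SytBallot⇒labels : ∀ {s d w} → SytBallot s d w → All SytLabel w
SytBallot⇒labels []          = []
SytBallot⇒labels (top∷ b)    = isTop ∷ SytBallot⇒labels b
SytBallot⇒labels (bottom∷ b) = isBottom ∷ SytBallot⇒labels b
SytBallot⇒labels (col∷ b)    = isCol ∷ SytBallot⇒labels b

Ballot⇒SytBallot : ∀ {s d w} → Ballot d w → All SytLabel w →
                   (s ≡ false → nextInColumn w ≡ false) → SytBallot s d w
Ballot⇒SytBallot []          _        _     = []
Ballot⇒SytBallot (top∷ b)    (_ ∷ ls) start = top∷ Ballot⇒SytBallot b ls start
Ballot⇒SytBallot (bottom∷ b) (_ ∷ ls) _     = bottom∷ Ballot⇒SytBallot b ls (λ ())
Ballot⇒SytBallot (both∷ b)   (() ∷ _) _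
Ballot⇒SytBallot {false} (col∷ b) (_ ∷ ls) start with start refl
... | ()
Ballot⇒SytBallot {true}  (col∷ b) (_ ∷ ls) _ = col∷ Ballot⇒SytBallot b ls (λ ())

places : Label → ℕ
places (lab a b c) = bit a + (bit b + bit c)

weight : Word → ℕ
weight u = count inRow₁ u + (count inRow₂ u + count inColumn u)

weight-∷ : ∀ l u → weight (l ∷ u) ≡ places l + weight u
weight-∷ (lab a b c) u =
  solve 6 (λ a b c x y z → (a :+ x) :+ ((b :+ y) :+ (c :+ z)) := (a :+ (b :+ c)) :+ (x :+ (y :+ z)))
    refl (bit a) (bit b) (bit c) (count inRow₁ u) (count inRow₂ u) (count inColumn u)
  where open +-*-Solver

weight-syt : ∀ {u} → All SytLabel u → weight u ≡ length u
weight-syt {[]}    []         = refl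
weight-syt {l ∷ u} (sl ∷ sls) = trans (weight-∷ l u) (cong₂ _+_ (one sl) (weight-syt sls))
  where
  one : ∀ {l} → SytLabel l → places l ≡ 1
  one isTop    = refl
  one isBottom = refl
  one isCol    = refl

occupied-places : ∀ l → Occupied l → 1 ≤ places l
occupied-places (lab true  _     _    ) _ = s≤s z≤n
occupied-places (lab false true  _    ) _ = s≤s z≤n
occupied-places (lab false false true ) _ = s≤s z≤n
occupied-places (lab false false false) ()

single-place : ∀ l → places l ≡ 1 → SytLabel l
single-place (lab true  false false) _ = isTop
single-place (lab false true  false) _ = isBottom
single-place (lab false false true ) _ = isCol
single-place (lab true  true  _    ) ()
single-place (lab true  false true ) ()
single-place (lab false true  true ) ()
single-place (lab false false false) ()

length≤weight : ∀ {u} → All Occupied u → length u ≤ weight u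
length≤weight {[]}    []           = z≤n
length≤weight {l ∷ u} (occ ∷ occs) =
  subst (suc (length u) ≤_) (sym (weight-∷ l u)) (+-mono-≤ (occupied-places l occ) (length≤weight occs))

tight : ∀ {a b c} → 1 ≤ a → c ≤ b → a + b ≡ suc c → a ≡ 1 × b ≡ c
tight {a} {b} {c} 1≤a c≤b eq = a≡1 , suc-injective (trans (cong (_+ b) (sym a≡1)) eq)
  where
  a≡1 : a ≡ 1
  a≡1 = ≤-antisym (+-cancelʳ-≤ b a 1 (subst (_≤ suc b) (sym eq) (s≤s c≤b))) 1≤a

exactly-once : ∀ u → All Occupied u → weight u ≡ length u → All SytLabel u
exactly-once []      []           _  = []
exactly-once (l ∷ u) (occ ∷ occs) eq
  with tight (occupied-places l occ) (length≤weight occs) (trans (sym (weight-∷ l u)) eq)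
... | one , rest = single-place l one ∷ exactly-once u occs rest

incFilling : Word → Filling
incFilling w = positions inRow₁ 1 w ∷ positions inRow₂ 1 w ∷ []

sytFilling : Word → Filling
sytFilling u = positions inRow₁ 1 u ∷ positions inRow₂ 1 u ∷ map [_] (positions inColumn 1 u)

filter-row₁ : ∀ {P : ℕ → Set} (P? : Decidable P) m w carry → All IncLabel w →
  (∀ v → v ∈ positions inRow₁ m w → v ∈ positions inRow₂ m w → ¬ P v) →
  (∀ v → v ∈ positions inRow₁ m w → v ∉ positions inRow₂ m w → P v) →
  filter P? (positions inRow₁ m w) ≡ positions inRow₁ m (toSytWord carry w)
filter-row₁ P? m []      carry _ _ _ = refl
filter-row₁ P? m (top ∷ w) carry (isTop ∷ ls) reject keep =
  trans (filter-accept P? (keep m (here refl) (<-∉ (positions-> inRow₂ m w))))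
        (cong (m ∷_) (filter-row₁ P? (suc m) w carry ls (λ v i₁ i₂ → reject v (there i₁) i₂) (λ v i₁ n₂ → keep v (there i₁) n₂)))
filter-row₁ P? m (bottom ∷ w) carry (isBottom ∷ ls) reject keep =
  filter-row₁ P? (suc m) w false ls (λ v i₁ i₂ → reject v i₁ (there i₂))
    (λ v i₁ n₂ → keep v i₁ (∉-∷ (positions-> inRow₁ m w) i₁ n₂))
filter-row₁ P? m (both ∷ w) carry (isBoth ∷ ls) reject keep =
  trans (filter-reject P? (reject m (here refl) (here refl)))
    (filter-row₁ P? (suc m) w true ls (λ v i₁ i₂ → reject v (there i₁) (there i₂))
      (λ v i₁ n₂ → keep v (there i₁) (∉-∷ (positions-> inRow₁ m w) i₁ n₂)))

filter-row₂ : ∀ {P : ℕ → Set} (P? : Decidable P) m w carry → All IncLabel w →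
  (∀ v → v ∈ positions inRow₂ m w → v ∈ positions inColumn m (toSytWord carry w) → ¬ P v) →
  (∀ v → v ∈ positions inRow₂ m w → v ∉ positions inColumn m (toSytWord carry w) → P v) →
  filter P? (positions inRow₂ m w) ≡ positions inRow₂ m (toSytWord carry w)
filter-row₂ P? m [] carry _ _ _ = refl
filter-row₂ P? m (top ∷ w) carry (isTop ∷ ls) reject keep = filter-row₂ P? (suc m) w carry ls reject keep
filter-row₂ P? m (lab a true false ∷ w) true (_ ∷ ls) reject keep =
  trans (filter-reject P? (reject m (here refl) (here refl)))
    (filter-row₂ P? (suc m) w a ls (λ v i₂ i₃ → reject v (there i₂) (there i₃))
      (λ v i₂ n₃ → keep v (there i₂) (∉-∷ (positions-> inRow₂ m w) i₂ n₃)))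
filter-row₂ P? m (lab a true false ∷ w) false (_ ∷ ls) reject keep =
  trans (filter-accept P? (keep m (here refl) (<-∉ (positions-> inColumn m (toSytWord a w)))))
    (cong (m ∷_) (filter-row₂ P? (suc m) w a ls (λ v i₂ i₃ → reject v (there i₂) i₃)
      (λ v i₂ n₃ → keep v (there i₂) n₃)))

-- rightOfIn with the membership test of the previous entry already performed.
rightOfAfter : List ℕ → Bool → List ℕ → List ℕ
rightOfAfter A _     []      = []
rightOfAfter A true  (y ∷ r) = y ∷ rightOfAfter A (does (y ∈? A)) r
rightOfAfter A false (y ∷ r) = rightOfAfter A (does (y ∈? A)) r

rightOfIn-after : ∀ A x r → rightOfIn A (x ∷ r) ≡ rightOfAfter A (does (x ∈? A)) r
rightOfIn-after A x []      with does (x ∈? A)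
... | true  = refl
... | false = refl
rightOfIn-after A x (y ∷ r) with does (x ∈? A)
... | true  = cong (y ∷_) (rightOfIn-after A y r)
... | false = rightOfIn-after A y r

rightOfIn-start : ∀ A xs → rightOfIn A xs ≡ rightOfAfter A false xs
rightOfIn-start A []      = refl
rightOfIn-start A (x ∷ r) = rightOfIn-after A x r

rightOfAfter-∷ : ∀ A b y r → rightOfAfter A b (y ∷ r) ≡ consIf b y (rightOfAfter A (does (y ∈? A)) r)
rightOfAfter-∷ A true  y r = refl
rightOfAfter-∷ A false y r = refl

rightOf-column : ∀ A m w carry → All IncLabel w →
  (∀ v → v ∈ positions inRow₂ m w → v ∈ A → v ∈ positions inRow₁ m w) →
  (∀ v → v ∈ positions inRow₂ m w → v ∈ positions inRow₁ m w → v ∈ A) →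
  rightOfAfter A carry (positions inRow₂ m w) ≡ positions inColumn m (toSytWord carry w)
rightOf-column A m [] carry _ _ _ = refl
rightOf-column A m (top ∷ w) carry (isTop ∷ ls) onlyBoth allBoth =
  rightOf-column A (suc m) w carry ls
    (λ v i₂ v∈A → ∈-consIf⁻ true (onlyBoth v i₂ v∈A) (<-≢ (positions-> inRow₂ m w) i₂))
    (λ v i₂ i₁ → allBoth v i₂ (there i₁))
rightOf-column A m (lab a true false ∷ w) carry (l ∷ ls) onlyBoth allBoth = begin
  rightOfAfter A carry (m ∷ positions inRow₂ (suc m) w)
    ≡⟨ rightOfAfter-∷ A carry m _ ⟩
  consIf carry m (rightOfAfter A (does (m ∈? A)) (positions inRow₂ (suc m) w))
    ≡⟨ cong (λ b → consIf carry m (rightOfAfter A b (positions inRow₂ (suc m) w))) (decided l) ⟩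
  consIf carry m (rightOfAfter A a (positions inRow₂ (suc m) w))
    ≡⟨ cong (consIf carry m) (rightOf-column A (suc m) w a ls onlyBoth′ allBoth′) ⟩
  consIf carry m (positions inColumn (suc m) (toSytWord a w))
    ∎
  where
  open ≡-Reasoning
  decided : IncLabel (lab a true false) → does (m ∈? A) ≡ a
  decided isBottom = dec-false (m ∈? A) (λ m∈A → <-∉ (positions-> inRow₁ m w) (onlyBoth m (here refl) m∈A))
  decided isBoth   = dec-true (m ∈? A) (allBoth m (here refl) (here refl))
  onlyBoth′ : ∀ v → v ∈ positions inRow₂ (suc m) w → v ∈ A → v ∈ positions inRow₁ (suc m) w
  onlyBoth′ v i₂ v∈A = ∈-consIf⁻ a (onlyBoth v (there i₂) v∈A) (<-≢ (positions-> inRow₂ m w) i₂)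
  allBoth′ : ∀ v → v ∈ positions inRow₂ (suc m) w → v ∈ positions inRow₁ (suc m) w → v ∈ A
  allBoth′ v i₂ i₁ = allBoth v (there i₂) (∈-consIf⁺ a i₁)

sort-increasing : ∀ xs → Increasing xs → sort xs ≡ xs
sort-increasing xs inc = Pointwise-≡⇒≡
  (↗↭↗⇒≋ (DecTotalOrder.totalOrder ≤-decTotalOrder) (sort-↗ xs) (Linked.map <⇒≤ inc) (↭⇒↭ₛ (sort-↭ xs)))

𝓕-word : ∀ w → All IncLabel w → 𝓕 (incFilling w) ≡ sytFilling (toSytWord false w)
𝓕-word w ls = cong₂ _∷_ row₁ (cong₂ _∷_ row₂ (cong (map [_]) column))
  where
  r₁ = positions inRow₁ 1 w
  r₂ = positions inRow₂ 1 w
  A = filter (_∈? r₂) r₁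
  B = rightOfIn A r₂
  u = toSytWord false w
  ∈A⁺ : ∀ {v} → v ∈ r₁ → v ∈ r₂ → v ∈ A
  ∈A⁺ = ∈-filter⁺ (_∈? r₂)
  ∈A⁻ : ∀ {v} → v ∈ A → v ∈ r₁ × v ∈ r₂
  ∈A⁻ = ∈-filter⁻ (_∈? r₂) {xs = r₁}
  B≡column : B ≡ positions inColumn 1 u
  B≡column = trans (rightOfIn-start A r₂)
    (rightOf-column A 1 w false ls (λ _ _ v∈A → proj₁ (∈A⁻ v∈A)) (λ _ i₂ i₁ → ∈A⁺ i₁ i₂))
  row₁ : filter (_∉? A) r₁ ≡ positions inRow₁ 1 u
  row₁ = filter-row₁ (_∉? A) 1 w false ls
    (λ _ i₁ i₂ v∉A → v∉A (∈A⁺ i₁ i₂)) (λ _ _ v∉r₂ v∈A → v∉r₂ (proj₂ (∈A⁻ v∈A)))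
  row₂ : filter (_∉? B) r₂ ≡ positions inRow₂ 1 u
  row₂ = filter-row₂ (_∉? B) 1 w false ls
    (λ v _ i₃ v∉B → v∉B (subst (v ∈_) (sym B≡column) i₃)) (λ v _ v∉col v∈B → v∉col (subst (v ∈_) B≡column v∈B))
  column : sort B ≡ positions inColumn 1 u
  column = trans (cong sort B≡column) (sort-increasing _ (positions-increasing inColumn 1 u))

IncLabels⇒no-column : ∀ m w → All IncLabel w → positions inColumn m w ≡ []
IncLabels⇒no-column m []      []         = refl
IncLabels⇒no-column m (_ ∷ w) (isTop ∷ ls)    = IncLabels⇒no-column (suc m) w ls
IncLabels⇒no-column m (_ ∷ w) (isBottom ∷ ls) = IncLabels⇒no-column (suc m) w ls
IncLabels⇒no-column m (_ ∷ w) (isBoth ∷ ls)   = IncLabels⇒no-column (suc m) w ls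

no-column⇒IncLabels : ∀ m w → All Occupied w → positions inColumn m w ≡ [] → All IncLabel w
no-column⇒IncLabels m []                          _          _  = []
no-column⇒IncLabels m (lab _     _     true  ∷ w) _          ()
no-column⇒IncLabels m (lab true  false false ∷ w) (_ ∷ occs) eq = isTop ∷ no-column⇒IncLabels (suc m) w occs eq
no-column⇒IncLabels m (lab false true  false ∷ w) (_ ∷ occs) eq = isBottom ∷ no-column⇒IncLabels (suc m) w occs eq
no-column⇒IncLabels m (lab true  true  false ∷ w) (_ ∷ occs) eq = isBoth ∷ no-column⇒IncLabels (suc m) w occs eq
no-column⇒IncLabels m (lab false false false ∷ w) (() ∷ _)   _

row-in-range : ∀ {N xs r} → ValuesUpTo N xs → (∀ {v} → v ∈ r → v ∈ xs) → Increasing r → InRange 1 N r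
row-in-range vals sub inc =
  inc , All.tabulate (λ v∈ → proj₁ (proj₁ (vals _) (sub v∈))) , All.tabulate (λ v∈ → s≤s (proj₂ (proj₁ (vals _) (sub v∈))))

values-cover : ∀ {N} r₁ r₂ c → ValuesUpTo N (r₁ ++ (r₂ ++ c)) → Covers 1 N r₁ r₂ c
values-cover r₁ r₂ c vals v 1≤v v< = ∈-++³⁻ r₁ r₂ (proj₂ (vals v) (1≤v , ≤-pred v<))

decode-filling : ∀ N r₁ r₂ c → ValuesUpTo N (r₁ ++ (r₂ ++ c)) → Increasing r₁ → Increasing r₂ → Increasing c →
  ∃ λ w → length w ≡ N × All Occupied w ×
          positions inRow₁ 1 w ≡ r₁ × positions inRow₂ 1 w ≡ r₂ × positions inColumn 1 w ≡ c
decode-filling N r₁ r₂ c vals inc₁ inc₂ inc₃ = decode N 1 r₁ r₂ c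
  (row-in-range vals ∈-++⁺ˡ inc₁) (row-in-range vals (∈-++⁺ʳ r₁ ∘′ ∈-++⁺ˡ) inc₂)
  (row-in-range vals (∈-++⁺ʳ r₁ ∘′ ∈-++⁺ʳ r₂) inc₃) (values-cover r₁ r₂ c vals)

IncWord : ℕ → ℕ → Word → Set
IncWord n k w = IncBallot 0 w × count inRow₁ w ≡ n × length w ≡ size (twoBy n) ∸ k

inc-decode : ∀ n k T → IsInc k (twoBy n) T → ∃ λ w → T ≡ incFilling w × IncWord n k w
inc-decode n k (r₁ ∷ r₂ ∷ []) (shape≡ , (inc₁ ∷ inc₂ ∷ []) , (below ∷ [-]) , vals)
  with decode-filling (size (twoBy n) ∸ k) r₁ r₂ [] vals inc₁ inc₂ []
... | w , len , occs , refl , refl , noColumn = w , refl , ballot , count₁ , len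
  where
  ls = no-column⇒IncLabels 1 w occs noColumn
  count₁ : count inRow₁ w ≡ n
  count₁ = trans (sym (length-positions inRow₁ 1 w)) (∷-injectiveˡ shape≡)
  count₂ : count inRow₂ w ≡ n
  count₂ = trans (sym (length-positions inRow₂ 1 w)) (∷-injectiveˡ (∷-injectiveʳ shape≡))
  ballot : IncBallot 0 w
  ballot = Ballot⇒IncBallot (stacked⇒ballot w 1 [] (All.map IncLabel⇒Simple ls) []
    (ColBelow⇒Stacked _ _ below) (trans count₁ (sym count₂))) ls

inc-encode : ∀ n k w → IncWord n k w → IsInc k (twoBy n) (incFilling w)
inc-encode n k w (ballot , count₁ , len) =
  shape≡ , (positions-increasing inRow₁ 1 w ∷ positions-increasing inRow₂ 1 w ∷ []) ,
  (Stacked⇒ColBelow (ballot⇒stacked (IncBallot⇒Ballot ballot) 1 [] refl []) ∷ [-]) , vals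
  where
  ls = IncBallot⇒labels ballot
  count₂ : count inRow₂ w ≡ n
  count₂ = trans (sym (ballot-count (IncBallot⇒Ballot ballot))) count₁
  shape≡ : shape (incFilling w) ≡ twoBy n
  shape≡ = cong₂ _∷_ (trans (length-positions inRow₁ 1 w) count₁)
                     (cong₂ _∷_ (trans (length-positions inRow₂ 1 w) count₂) refl)
  vals : ValuesUpTo (size (twoBy n) ∸ k) (concat (incFilling w))
  vals = subst₂ ValuesUpTo len (cong (λ c → positions inRow₁ 1 w ++ (positions inRow₂ 1 w ++ c)) (IncLabels⇒no-column 1 w ls))
           (entries-values w (All.map (Simple⇒Occupied ∘′ IncLabel⇒Simple) ls))

column-shape : ∀ c → shape (map [_] c) ≡ replicate (length c) 1
column-shape []      = refl
column-shape (_ ∷ c) = cong (1 ∷_) (column-shape c)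

column-rows : ∀ rest k → shape rest ≡ replicate k 1 → ∃ λ c → rest ≡ map [_] c × length c ≡ k
column-rows []                  zero    _  = [] , refl , refl
column-rows ((x ∷ []) ∷ rest)   (suc k) eq with column-rows rest k (∷-injectiveʳ eq)
... | c , refl , len = x ∷ c , refl , cong suc len

sum-ones : ∀ k → sum (replicate k 1) ≡ k
sum-ones zero    = refl
sum-ones (suc k) = cong suc (sum-ones k)

column-strict⁻ : ∀ r₂ c → Linked ColBelow (r₂ ∷ map [_] c) → Stacked r₂ (take 1 c) × Increasing c
column-strict⁻ r₂ []      _               = stacked-[] r₂ , []
column-strict⁻ r₂ (x ∷ c) (below ∷ belows) =
  ColBelow⇒Stacked r₂ (x ∷ []) below , Linked.map (λ below′ → below′ 0 _ _ refl refl) (Linkedₚ.map⁻ belows)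

column-strict⁺ : ∀ r₂ c → Stacked r₂ (take 1 c) → Increasing c → Linked ColBelow (r₂ ∷ map [_] c)
column-strict⁺ r₂ []      _     _   = [-]
column-strict⁺ r₂ (x ∷ c) below inc =
  Stacked⇒ColBelow below ∷ Linkedₚ.map⁺ (Linked.map (λ x<y → Stacked⇒ColBelow (cell x<y nil₁)) inc)

stacked-column⇒start : ∀ m u → All SytLabel u → 1 ≤ length (positions inRow₂ m u) →
  Stacked (positions inRow₂ m u) (take 1 (positions inColumn m u)) → nextInColumn u ≡ false
stacked-column⇒start m []      _              _        _     = refl
stacked-column⇒start m (_ ∷ u) (isTop ∷ ls)    nonempty below = stacked-column⇒start (suc m) u ls nonempty below
stacked-column⇒start m (_ ∷ u) (isBottom ∷ ls) _        _     = refl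
stacked-column⇒start m (_ ∷ u) (isCol ∷ ls)    nonempty below =
  ⊥-elim (unmatched-bottom (positions inRow₂ (suc m) u) [] (positions-> inRow₂ m u) nonempty below)

start⇒stacked-column : ∀ m u → All SytLabel u → nextInColumn u ≡ false →
  Stacked (positions inRow₂ m u) (take 1 (positions inColumn m u))
start⇒stacked-column m []      _               _ = nil₁
start⇒stacked-column m (_ ∷ u) (isTop ∷ ls)    start = start⇒stacked-column (suc m) u ls start
start⇒stacked-column m (_ ∷ u) (isBottom ∷ ls) _ with positions inColumn (suc m) u | positions-> inColumn m u
... | []    | _         = nil₂
... | _ ∷ _ | m<x ∷ _   = cell m<x (stacked-[] _)
start⇒stacked-column m (_ ∷ u) (isCol ∷ ls)    ()

hook-size : ∀ a k → size (twoRowsHook a k) ∸ 0 ≡ a + (a + k)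
hook-size a k = cong (λ z → a + (a + z)) (sum-ones k)

SytWord : ℕ → ℕ → Word → Set
SytWord a k u = SytBallot false 0 u × count inRow₁ u ≡ a × count inColumn u ≡ k

syt-decode : ∀ a k S → 1 ≤ a → IsSYT (twoRowsHook a k) S → ∃ λ u → S ≡ sytFilling u × SytWord a k u
syt-decode a k (r₁ ∷ r₂ ∷ rest) 1≤a (shape≡ , (inc₁ ∷ inc₂ ∷ _) , (below ∷ belows) , vals)
  with column-rows rest k (∷-injectiveʳ (∷-injectiveʳ shape≡))
... | c , refl , length-c with column-strict⁻ r₂ c belows
... | below-column , inc₃
  with decode-filling _ r₁ r₂ c (subst (λ c′ → ValuesUpTo _ (r₁ ++ (r₂ ++ c′))) (concat-map-[ c ]) vals) inc₁ inc₂ inc₃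
... | u , len , occs , refl , refl , refl = u , refl , ballot , count₁ , count₃
  where
  count₁ : count inRow₁ u ≡ a
  count₁ = trans (sym (length-positions inRow₁ 1 u)) (∷-injectiveˡ shape≡)
  count₂ : count inRow₂ u ≡ a
  count₂ = trans (sym (length-positions inRow₂ 1 u)) (∷-injectiveˡ (∷-injectiveʳ shape≡))
  count₃ : count inColumn u ≡ k
  count₃ = trans (sym (length-positions inColumn 1 u)) length-c
  ls : All SytLabel u
  ls = exactly-once u occs
         (trans (cong₂ _+_ count₁ (cong₂ _+_ count₂ count₃)) (trans (sym (hook-size a k)) (sym len)))
  start : nextInColumn u ≡ false
  start = stacked-column⇒start 1 u ls (subst (1 ≤_) (sym (trans (length-positions inRow₂ 1 u) count₂)) 1≤a) below-column
  ballot : SytBallot false 0 u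
  ballot = Ballot⇒SytBallot (stacked⇒ballot u 1 [] (All.map SytLabel⇒Simple ls) [] (ColBelow⇒Stacked _ _ below)
             (trans count₁ (sym count₂))) ls (λ _ → start)

syt-encode : ∀ a k u → SytWord a k u → IsSYT (twoRowsHook a k) (sytFilling u)
syt-encode a k u (ballot , count₁ , count₃) =
  shape≡ ,
  (positions-increasing inRow₁ 1 u ∷ positions-increasing inRow₂ 1 u ∷ Allₚ.map⁺ (All.universal (λ _ → [-]) _)) ,
  (Stacked⇒ColBelow (ballot⇒stacked (SytBallot⇒Ballot ballot) 1 [] refl []) ∷
   column-strict⁺ _ _ (start⇒stacked-column 1 u ls (nextInColumn-start ballot)) (positions-increasing inColumn 1 u)) ,
  subst₂ ValuesUpTo len (cong (λ c → positions inRow₁ 1 u ++ (positions inRow₂ 1 u ++ c)) (sym (concat-map-[ _ ])))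
    (entries-values u (All.map (Simple⇒Occupied ∘′ SytLabel⇒Simple) ls))
  where
  ls = SytBallot⇒labels ballot
  count₂ : count inRow₂ u ≡ a
  count₂ = trans (sym (ballot-count (SytBallot⇒Ballot ballot))) count₁
  shape≡ : shape (sytFilling u) ≡ twoRowsHook a k
  shape≡ = cong₂ _∷_ (trans (length-positions inRow₁ 1 u) count₁)
    (cong₂ _∷_ (trans (length-positions inRow₂ 1 u) count₂)
      (trans (column-shape _) (cong (λ z → replicate z 1) (trans (length-positions inColumn 1 u) count₃))))
  len : length u ≡ size (twoRowsHook a k) ∸ 0
  len = trans (sym (weight-syt ls)) (trans (cong₂ _+_ count₁ (cong₂ _+_ count₂ count₃)) (sym (hook-size a k)))

two-row-size : ∀ n k → k ≤ n → (n ∸ k) + ((n ∸ k) + k) ≡ size (twoBy n) ∸ k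
two-row-size n k k≤n = begin
  (n ∸ k) + ((n ∸ k) + k) ≡⟨ cong ((n ∸ k) +_) (m∸n+n≡m k≤n) ⟩
  (n ∸ k) + n             ≡⟨ +-∸-comm n k≤n ⟨
  n + n ∸ k               ≡⟨ cong (λ z → n + z ∸ k) (+-identityʳ n) ⟨
  n + (n + 0) ∸ k         ∎
  where open ≡-Reasoning

hook-counts : ∀ {n k x y} → k ≤ n → x + y ≡ n → x + (x + y) ≡ size (twoBy n) ∸ k → x ≡ n ∸ k × y ≡ k
hook-counts {n} {k} {x} {y} k≤n x+y≡n total = x≡n∸k , y≡k
  where
  open ≡-Reasoning
  x≡n∸k : x ≡ n ∸ k
  x≡n∸k = +-cancelʳ-≡ n x (n ∸ k) (begin
    x + n                   ≡⟨ cong (x +_) x+y≡n ⟨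
    x + (x + y)             ≡⟨ total ⟩
    size (twoBy n) ∸ k      ≡⟨ two-row-size n k k≤n ⟨
    (n ∸ k) + ((n ∸ k) + k) ≡⟨ cong ((n ∸ k) +_) (m∸n+n≡m k≤n) ⟩
    (n ∸ k) + n             ∎)
  y≡k : y ≡ k
  y≡k = +-cancelˡ-≡ x y k (begin
    x + y       ≡⟨ x+y≡n ⟩
    n           ≡⟨ m∸n+n≡m k≤n ⟨
    (n ∸ k) + k ≡⟨ cong (_+ k) x≡n∸k ⟨
    x + k       ∎)

toSyt-word : ∀ n k w → k ≤ n → IncWord n k w → SytWord (n ∸ k) k (toSytWord false w)
toSyt-word n k w k≤n (ballot , count₁ , len) = sytBallot , hook-counts k≤n split total
  where
  open ≡-Reasoning
  u = toSytWord false w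
  sytBallot : SytBallot false 0 u
  sytBallot = toSyt-ballot ballot
  split : count inRow₁ u + count inColumn u ≡ n
  split = trans (sym (count-toSyt ballot)) count₁
  total : count inRow₁ u + (count inRow₁ u + count inColumn u) ≡ size (twoBy n) ∸ k
  total = begin
    count inRow₁ u + (count inRow₁ u + count inColumn u)
      ≡⟨ cong (λ c₂ → count inRow₁ u + (c₂ + count inColumn u)) (ballot-count (SytBallot⇒Ballot sytBallot)) ⟩
    weight u ≡⟨ weight-syt (SytBallot⇒labels sytBallot) ⟩
    length u ≡⟨ length-toSyt false w ⟩
    length w ≡⟨ len ⟩
    size (twoBy n) ∸ k ∎

toInc-word : ∀ n k u → k ≤ n → SytWord (n ∸ k) k u →
             IncWord n k (toIncWord u) × toSytWord false (toIncWord u) ≡ u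
toInc-word n k u k≤n (ballot , count₁ , count₃) = (incBallot , count₁′ , len) , inverse
  where
  open ≡-Reasoning
  start = nextInColumn-start ballot
  incBallot : IncBallot 0 (toIncWord u)
  incBallot = toInc-ballot ballot start
  inverse : toSytWord false (toIncWord u) ≡ u
  inverse = subst (λ b → toSytWord b (toIncWord u) ≡ u) start (toSyt-toInc ballot)
  count₂ : count inRow₂ u ≡ n ∸ k
  count₂ = trans (sym (ballot-count (SytBallot⇒Ballot ballot))) count₁
  count₁′ : count inRow₁ (toIncWord u) ≡ n
  count₁′ = begin
    count inRow₁ (toIncWord u)
      ≡⟨ count-toSyt incBallot ⟩
    count inRow₁ (toSytWord false (toIncWord u)) + count inColumn (toSytWord false (toIncWord u))
      ≡⟨ cong (λ u′ → count inRow₁ u′ + count inColumn u′) inverse ⟩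
    count inRow₁ u + count inColumn u ≡⟨ cong₂ _+_ count₁ count₃ ⟩
    (n ∸ k) + k                       ≡⟨ m∸n+n≡m k≤n ⟩
    n ∎
  len : length (toIncWord u) ≡ size (twoBy n) ∸ k
  len = begin
    length (toIncWord u)                   ≡⟨ length-toSyt false (toIncWord u) ⟨
    length (toSytWord false (toIncWord u)) ≡⟨ cong length inverse ⟩
    length u                               ≡⟨ weight-syt (SytBallot⇒labels ballot) ⟨
    weight u                               ≡⟨ cong₂ _+_ count₁ (cong₂ _+_ count₂ count₃) ⟩
    (n ∸ k) + ((n ∸ k) + k)                ≡⟨ two-row-size n k k≤n ⟩
    size (twoBy n) ∸ k ∎

𝓕-maps-into : ∀ n k → k ≤ n → ∀ T → IsInc k (twoBy n) T → IsSYT (twoRowsHook (n ∸ k) k) (𝓕 T)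
𝓕-maps-into n k k≤n T T-inc with inc-decode n k T T-inc
... | w , refl , w-inc = subst (IsSYT (twoRowsHook (n ∸ k) k)) (sym (𝓕-word w (IncBallot⇒labels (proj₁ w-inc))))
                            (syt-encode (n ∸ k) k (toSytWord false w) (toSyt-word n k w k≤n w-inc))

𝓕-injective : ∀ n k T U → IsInc k (twoBy n) T → IsInc k (twoBy n) U → 𝓕 T ≡ 𝓕 U → T ≡ U
𝓕-injective n k T U T-inc U-inc 𝓕T≡𝓕U with inc-decode n k T T-inc | inc-decode n k U U-inc
... | w , refl , (ballot , _) | w′ , refl , (ballot′ , _) = cong incFilling (begin
  w                               ≡⟨ toInc-toSyt ballot ⟨
  toIncWord (toSytWord false w)   ≡⟨ cong toIncWord (sytFilling-injective images) ⟩
  toIncWord (toSytWord false w′)  ≡⟨ toInc-toSyt ballot′ ⟩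
  w′ ∎)
  where
  open ≡-Reasoning
  images : sytFilling (toSytWord false w) ≡ sytFilling (toSytWord false w′)
  images = trans (sym (𝓕-word w (IncBallot⇒labels ballot))) (trans 𝓕T≡𝓕U (𝓕-word w′ (IncBallot⇒labels ballot′)))
  occupied : ∀ {w} → IncBallot 0 w → All Occupied (toSytWord false w)
  occupied b = All.map (Simple⇒Occupied ∘′ SytLabel⇒Simple) (SytBallot⇒labels (toSyt-ballot {s = false} b))
  sytFilling-injective : sytFilling (toSytWord false w) ≡ sytFilling (toSytWord false w′) → toSytWord false w ≡ toSytWord false w′
  sytFilling-injective eq = positions-injective 1 _ _ (occupied ballot) (occupied ballot′)
    (∷-injectiveˡ eq) (∷-injectiveˡ (∷-injectiveʳ eq)) (map-injective ∷-injectiveˡ (∷-injectiveʳ (∷-injectiveʳ eq)))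

𝓕-onto : ∀ n k → k ≤ n → 1 ≤ n ∸ k → ∀ S → IsSYT (twoRowsHook (n ∸ k) k) S → ∃ λ T → IsInc k (twoBy n) T × 𝓕 T ≡ S
𝓕-onto n k k≤n 1≤n∸k S S-syt with syt-decode (n ∸ k) k S 1≤n∸k S-syt
... | u , refl , u-syt with toInc-word n k u k≤n u-syt
... | w-inc , inverse = incFilling (toIncWord u) , inc-encode n k (toIncWord u) w-inc ,
  trans (𝓕-word (toIncWord u) (IncBallot⇒labels (proj₁ w-inc))) (cong sytFilling inverse)

proposition2p1 : (n k : ℕ) → 1 ≤ n → k ≤ n ∸ 1 →
    (∀ T → IsInc k (twoBy n) T → IsSYT (twoRowsHook (n ∸ k) k) (𝓕 T))
    × (∀ T U → IsInc k (twoBy n) T → IsInc k (twoBy n) U → 𝓕 T ≡ 𝓕 U → T ≡ U)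
    × (∀ S → IsSYT (twoRowsHook (n ∸ k) k) S → ∃ λ T → IsInc k (twoBy n) T × 𝓕 T ≡ S)
proposition2p1 n k 1≤n k≤n-1 = 𝓕-maps-into n k k≤n , 𝓕-injective n k , 𝓕-onto n k k≤n 1≤n∸k
  where
  k≤n : k ≤ n
  k≤n = ≤-trans k≤n-1 (m∸n≤m n 1)
  -- the rows of 𝓕 T are nonempty
  1≤n∸k : 1 ≤ n ∸ k
  1≤n∸k = subst (_≤ n ∸ k) (m∸[m∸n]≡n 1≤n) (∸-monoʳ-≤ n k≤n-1)
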